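{- Let $G$ be a finite graph and let $D,D'\in\mathrm{Div}(G)$ with $D\sim D'$ and $D'$ effective. Then there exists a sequence of subset-firing moves transforming $D$ into $D'$ such that no subset-firing move introduces debt (i.e. makes a vertex with nonnegative coefficient negative), and no subset-firing move increases the debt on any vertex (i.e. no vertex with negative coefficient has its coefficient decreased).
   Context: A finite graph is a finite connected multigraph (multiple edges allowed, no loops). $\mathrm{Div}(G)$ is the free abelian group on $V(G)$; a vertex $v$ is in debt for $D$ if $D(v)<0$; $D$ is effective if no vertex is in debt. With $L$ the Laplacian of $G$, $D\sim D'$ means $D'=D-L\sigma$ for some $\sigma\in\mathbb{Z}^{V(G)}$. A subset-firing move by $U\subseteq V(G)$ transforms $D$ into $D-L\mathds{1}_U$, where $\mathds{1}_U$ is the indicator vector of $U$; equivalently each vertex of $U$ sends one chip along each edge to a neighbor outside $U$. -}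

module Defs where

open import Data.Nat using (ℕ; zero; suc; _>_)
open import Data.Integer using (ℤ; +_; _+_; _-_; _*_; _≤_; _<_; 0ℤ)
open import Data.Fin using (Fin; zero; suc)
open import Data.Bool using (Bool; true; false)
open import Data.Product using (Σ; ∃; _×_)
open import Relation.Binary.PropositionalEquality using (_≡_)

data Walk (k : ℕ) (m : Fin k → Fin k → ℕ) : Fin k → Fin k → Set where
  here : ∀ {v} → Walk k m v v
  step : ∀ {u v w} → m u v > 0 → Walk k m v w → Walk k m u w

record Graph : Set where
  field
    n      : ℕ
    mult   : Fin (suc n) → Fin (suc n) → ℕ
    sym    : ∀ u v → mult u v ≡ mult v u
    noLoop : ∀ v → mult v v ≡ 0

    connected : ∀ u v → Walk (suc n) mult u v

  V : Set
  V = Fin (suc n)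

open Graph public

∑ : ∀ {k} → (Fin k → ℤ) → ℤ
∑ {zero}  f = 0ℤ
∑ {suc k} f = f zero + ∑ (λ i → f (suc i))

Div : Graph → Set
Div G = V G → ℤ

-- Laplacian L = Deg − A applied to σ : (Lσ)(v) = Σ_w mult(v,w) (σ v − σ w)
Lap : (G : Graph) → (V G → ℤ) → V G → ℤ
Lap G σ v = ∑ (λ w → (+ mult G v w) * (σ v - σ w))

Linequiv : (G : Graph) → Div G → Div G → Set
Linequiv G D D' = Σ (V G → ℤ) λ σ → ∀ v → D' v ≡ D v - Lap G σ v

Effective : (G : Graph) → Div G → Set
Effective G D = ∀ v → 0ℤ ≤ D v

𝟙 : (G : Graph) → (V G → Bool) → V G → ℤ
𝟙 G U v with U v
... | true  = + 1
... | false = 0ℤ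

fire : (G : Graph) → Div G → (V G → Bool) → Div G
fire G D U v = D v - Lap G (𝟙 G U) v

Benign : (G : Graph) → Div G → (V G → Bool) → Set
Benign G D U = ∀ v → (0ℤ ≤ D v → 0ℤ ≤ fire G D U v)
                   × (D v < 0ℤ → D v ≤ fire G D U v)

data BenignSeq (G : Graph) : Div G → Div G → Set where
  done : ∀ {D D'} → (∀ v → D v ≡ D' v) → BenignSeq G D D'
  move : ∀ {D D'} (U : V G → Bool) → Benign G D U →
         BenignSeq G (fire G D U) D' → BenignSeq G D D'

-- Write D' = D − Lσ and fire the set U where σ attains its maximum, replacing
-- σ by σ − 𝟙_U; the spread max σ − min σ drops by one, so iterating reaches D'.
-- A vertex outside U minimises 𝟙_U, so (L𝟙_U)(v) ≤ 0 and it only gains chips.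
-- A vertex in U maximises the new potential σ − 𝟙_U, so L(σ − 𝟙_U) ≥ 0 there and
-- the fired divisor D − L𝟙_U = D' + L(σ − 𝟙_U) is at least D'(v) ≥ 0.
module Submission where

open import Defs hiding (sym)
open import Data.Nat using (zero; suc; z≤n)
open import Data.Nat.Properties using (n<1+n)
open import Data.Integer
  using (ℤ; +_; _+_; _-_; _*_; -_; _≤_; _<_; 0ℤ; 1ℤ; _⊓_; _⊔_; ∣_∣; _≤?_; +≤+; +<+)
import Data.Integer.Properties as ℤ
open import Data.Integer.Tactic.RingSolver using (solve-∀)
open import Data.Fin using (Fin; zero; suc)
open import Data.Bool using (Bool; true; false)
open import Data.Product using (_,_)
open import Data.Sum using (_⊎_; inj₁; inj₂)
open import Relation.Nullary using (yes; no; does; contradiction)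
open import Relation.Binary.PropositionalEquality

∑-cong : ∀ {k} {f g : Fin k → ℤ} → (∀ i → f i ≡ g i) → ∑ f ≡ ∑ g
∑-cong {zero}  f≡g = refl
∑-cong {suc k} f≡g = cong₂ _+_ (f≡g zero) (∑-cong (λ i → f≡g (suc i)))

∑-sub : ∀ {k} (f g : Fin k → ℤ) → ∑ (λ i → f i - g i) ≡ ∑ f - ∑ g
∑-sub {zero}  f g = refl
∑-sub {suc k} f g =
  trans (cong (λ s → (f zero - g zero) + s) (∑-sub (λ i → f (suc i)) (λ i → g (suc i))))
        (interchange (f zero) (g zero) _ _)
  where
  interchange : ∀ a b c d → (a - b) + (c - d) ≡ (a + c) - (b + d)
  interchange = solve-∀

∑-nonneg : ∀ {k} (f : Fin k → ℤ) → (∀ i → 0ℤ ≤ f i) → 0ℤ ≤ ∑ f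
∑-nonneg {zero}  f f≥0 = ℤ.≤-refl
∑-nonneg {suc k} f f≥0 = ℤ.+-mono-≤ (f≥0 zero) (∑-nonneg (λ i → f (suc i)) (λ i → f≥0 (suc i)))

∑-nonpos : ∀ {k} (f : Fin k → ℤ) → (∀ i → f i ≤ 0ℤ) → ∑ f ≤ 0ℤ
∑-nonpos {zero}  f f≤0 = ℤ.≤-refl
∑-nonpos {suc k} f f≤0 = ℤ.+-mono-≤ (f≤0 zero) (∑-nonpos (λ i → f (suc i)) (λ i → f≤0 (suc i)))

+n*i-nonneg : ∀ n i → 0ℤ ≤ i → 0ℤ ≤ + n * i
+n*i-nonneg n i i≥0 = subst (_≤ + n * i) (ℤ.*-zeroʳ (+ n)) (ℤ.*-monoˡ-≤-nonNeg (+ n) i≥0)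

+n*i-nonpos : ∀ n i → i ≤ 0ℤ → + n * i ≤ 0ℤ
+n*i-nonpos n i i≤0 = subst (+ n * i ≤_) (ℤ.*-zeroʳ (+ n)) (ℤ.*-monoˡ-≤-nonNeg (+ n) i≤0)

i<j⇒i≤j-1 : ∀ {i j} → i < j → i ≤ j - 1ℤ
i<j⇒i≤j-1 {j = j} i<j = subst (_ ≤_) (ℤ.+-comm (- 1ℤ) j) (ℤ.i<j⇒i≤pred[j] i<j)

0≤i-j⇒0≤j⇒0≤i : ∀ {i j} → 0ℤ ≤ i - j → 0ℤ ≤ j → 0ℤ ≤ i
0≤i-j⇒0≤j⇒0≤i {i} {j} 0≤i-j 0≤j = subst (0ℤ ≤_) (i-j+j≡i i j) (ℤ.+-mono-≤ 0≤i-j 0≤j)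
  where
  i-j+j≡i : ∀ i j → (i - j) + j ≡ i
  i-j+j≡i = solve-∀

-- Used for case splits instead of `with i ≤? j`, which would also abstract the
-- decision hidden inside 𝟙 (atLeast …) and block its reduction.
≤⊎> : ∀ i j → i ≤ j ⊎ j < i
≤⊎> i j with i ≤? j
... | yes i≤j = inj₁ i≤j
... | no i≰j  = inj₂ (ℤ.≰⇒> i≰j)

minimum : ∀ {k} → (Fin (suc k) → ℤ) → ℤ
minimum {zero}  f = f zero
minimum {suc k} f = f zero ⊓ minimum (λ i → f (suc i))

maximum : ∀ {k} → (Fin (suc k) → ℤ) → ℤ
maximum {zero}  f = f zero
maximum {suc k} f = f zero ⊔ maximum (λ i → f (suc i))

minimum≤ : ∀ {k} (f : Fin (suc k) → ℤ) i → minimum f ≤ f i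
minimum≤ {zero}  f zero    = ℤ.≤-refl
minimum≤ {suc k} f zero    = ℤ.i⊓j≤i (f zero) _
minimum≤ {suc k} f (suc i) = ℤ.≤-trans (ℤ.i⊓j≤j (f zero) _) (minimum≤ (λ i → f (suc i)) i)

≤maximum : ∀ {k} (f : Fin (suc k) → ℤ) i → f i ≤ maximum f
≤maximum {zero}  f zero    = ℤ.≤-refl
≤maximum {suc k} f zero    = ℤ.i≤i⊔j (f zero) _
≤maximum {suc k} f (suc i) = ℤ.≤-trans (≤maximum (λ i → f (suc i)) i) (ℤ.i≤j⊔i (f zero) _)

module _ (G : Graph) where

  Lap-sub : (τ ρ : V G → ℤ) (v : V G) →
            Lap G (λ w → τ w - ρ w) v ≡ Lap G τ v - Lap G ρ v
  Lap-sub τ ρ v =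
    trans (∑-cong (λ w → distrib (+ mult G v w) (τ v) (τ w) (ρ v) (ρ w)))
          (∑-sub (λ w → + mult G v w * (τ v - τ w)) (λ w → + mult G v w * (ρ v - ρ w)))
    where
    distrib : ∀ m a b c d → m * ((a - c) - (b - d)) ≡ m * (a - b) - m * (c - d)
    distrib = solve-∀

  Lap-nonneg-at-max : (τ : V G → ℤ) (v : V G) → (∀ w → τ w ≤ τ v) → 0ℤ ≤ Lap G τ v
  Lap-nonneg-at-max τ v τ≤τv =
    ∑-nonneg _ (λ w → +n*i-nonneg (mult G v w) _ (ℤ.i≤j⇒0≤j-i (τ≤τv w)))

  Lap-nonpos-at-min : (τ : V G → ℤ) (v : V G) → (∀ w → τ v ≤ τ w) → Lap G τ v ≤ 0ℤ
  Lap-nonpos-at-min τ v τv≤τ =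
    ∑-nonpos _ (λ w → +n*i-nonpos (mult G v w) _ (ℤ.i≤j⇒i-j≤0 (τv≤τ w)))

  Lap-const : (τ : V G → ℤ) (c : ℤ) → (∀ w → τ w ≡ c) → ∀ v → Lap G τ v ≡ 0ℤ
  Lap-const τ c τ≡c v = ℤ.≤-antisym
    (Lap-nonpos-at-min τ v (λ w → ℤ.≤-reflexive (trans (τ≡c v) (sym (τ≡c w)))))
    (Lap-nonneg-at-max τ v (λ w → ℤ.≤-reflexive (trans (τ≡c w) (sym (τ≡c v)))))

  fire-Linequiv : (D D' : Div G) (τ : V G → ℤ) (U : V G → Bool) →
                  (∀ v → D' v ≡ D v - Lap G τ v) →
                  ∀ v → D' v ≡ fire G D U v - Lap G (λ w → τ w - 𝟙 G U w) v
  fire-Linequiv D D' τ U D'≡ v = begin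
    D' v
      ≡⟨ D'≡ v ⟩
    D v - Lap G τ v
      ≡⟨ regroup (D v) (Lap G τ v) _ ⟩
    (D v - Lap G (𝟙 G U) v) - (Lap G τ v - Lap G (𝟙 G U) v)
      ≡⟨ cong (λ l → fire G D U v - l) (sym (Lap-sub τ (𝟙 G U) v)) ⟩
    fire G D U v - Lap G (λ w → τ w - 𝟙 G U w) v
      ∎
    where
    open ≡-Reasoning
    regroup : ∀ d l m → d - l ≡ (d - m) - (l - m)
    regroup = solve-∀

  𝟙-nonneg : (U : V G → Bool) (v : V G) → 0ℤ ≤ 𝟙 G U v
  𝟙-nonneg U v with U v
  ... | true  = +≤+ z≤n
  ... | false = ℤ.≤-refl

  atLeast : ℤ → (V G → ℤ) → V G → Bool
  atLeast t τ v = does (t ≤? τ v)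

  module _ (τ : V G → ℤ) (t : ℤ) where

    lowered : V G → ℤ
    lowered w = τ w - 𝟙 G (atLeast t τ) w

    𝟙-atLeast-top : ∀ {v} → t ≤ τ v → 𝟙 G (atLeast t τ) v ≡ 1ℤ
    𝟙-atLeast-top {v} t≤τv with t ≤? τ v
    ... | yes _    = refl
    ... | no t≰τv = contradiction t≤τv t≰τv

    𝟙-atLeast-below : ∀ {v} → τ v < t → 𝟙 G (atLeast t τ) v ≡ 0ℤ
    𝟙-atLeast-below {v} τv<t with t ≤? τ v
    ... | yes t≤τv = contradiction τv<t (ℤ.≤⇒≯ t≤τv)
    ... | no _     = refl

    lowered-top : ∀ {v} → t ≤ τ v → lowered v ≡ τ v - 1ℤ
    lowered-top {v} t≤τv = cong (λ i → τ v - i) (𝟙-atLeast-top t≤τv)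

    lowered-below : ∀ {v} → τ v < t → lowered v ≡ τ v
    lowered-below {v} τv<t =
      trans (cong (λ i → τ v - i) (𝟙-atLeast-below τv<t)) (ℤ.+-identityʳ (τ v))

    lowered≤ : (∀ w → τ w ≤ t) → ∀ v → lowered v ≤ t - 1ℤ
    lowered≤ τ≤t v with ≤⊎> t (τ v)
    ... | inj₁ t≤τv = ℤ.≤-trans (ℤ.≤-reflexive (lowered-top t≤τv)) (ℤ.+-monoˡ-≤ (- 1ℤ) (τ≤t v))
    ... | inj₂ τv<t = subst (_≤ t - 1ℤ) (sym (lowered-below τv<t)) (i<j⇒i≤j-1 τv<t)

    ≤lowered : ∀ {a} → a < t → (∀ w → a ≤ τ w) → ∀ v → a ≤ lowered v
    ≤lowered a<t a≤τ v with ≤⊎> t (τ v)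
    ... | inj₁ t≤τv = subst (_ ≤_) (sym (lowered-top t≤τv)) (i<j⇒i≤j-1 (ℤ.<-≤-trans a<t t≤τv))
    ... | inj₂ τv<t = subst (_ ≤_) (sym (lowered-below τv<t)) (a≤τ v)

  atLeast-benign : (D D' : Div G) (τ : V G → ℤ) (t : ℤ) → (∀ v → τ v ≤ t) →
                   (∀ v → D' v ≡ D v - Lap G τ v) → Effective G D' →
                   Benign G D (atLeast t τ)
  atLeast-benign D D' τ t τ≤t D'≡ D'≥0 v with ≤⊎> t (τ v)
  ... | inj₁ t≤τv = (λ _ → fire≥0) , (λ Dv<0 → ℤ.≤-trans (ℤ.<⇒≤ Dv<0) fire≥0)
    where
    lowered-max : ∀ w → lowered τ t w ≤ lowered τ t v
    lowered-max w = ℤ.≤-trans (lowered≤ τ t τ≤t w)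
      (ℤ.≤-reflexive (sym (trans (lowered-top τ t t≤τv)
                                 (cong (λ i → i - 1ℤ) (ℤ.≤-antisym (τ≤t v) t≤τv)))))
    fire≥0 : 0ℤ ≤ fire G D (atLeast t τ) v
    fire≥0 = 0≤i-j⇒0≤j⇒0≤i
      (subst (0ℤ ≤_) (fire-Linequiv D D' τ (atLeast t τ) D'≡ v) (D'≥0 v))
      (Lap-nonneg-at-max (lowered τ t) v lowered-max)
  ... | inj₂ τv<t = (λ Dv≥0 → ℤ.≤-trans Dv≥0 D≤fire) , (λ _ → D≤fire)
    where
    𝟙-min : ∀ w → 𝟙 G (atLeast t τ) v ≤ 𝟙 G (atLeast t τ) w
    𝟙-min w = subst (_≤ _) (sym (𝟙-atLeast-below τ t τv<t)) (𝟙-nonneg (atLeast t τ) w)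
    D≤fire : D v ≤ fire G D (atLeast t τ) v
    D≤fire = subst (_≤ fire G D (atLeast t τ) v) (ℤ.+-identityʳ (D v))
      (ℤ.+-monoʳ-≤ (D v) (ℤ.neg-mono-≤ (Lap-nonpos-at-min (𝟙 G (atLeast t τ)) v 𝟙-min)))

  benignSeq-of-bounded-potential :
    ∀ N a (τ : V G → ℤ) (D D' : Div G) → (∀ v → a ≤ τ v) → (∀ v → τ v ≤ a + + N) →
    (∀ v → D' v ≡ D v - Lap G τ v) → Effective G D' → BenignSeq G D D'
  benignSeq-of-bounded-potential zero a τ D D' a≤τ τ≤a D'≡ _ =
    done (λ v → sym (trans (D'≡ v) (trans (cong (λ l → D v - l) (Lap-const τ a τ≡a v))
                                          (ℤ.+-identityʳ (D v)))))
    where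
    τ≡a : ∀ v → τ v ≡ a
    τ≡a v = ℤ.≤-antisym (subst (τ v ≤_) (ℤ.+-identityʳ a) (τ≤a v)) (a≤τ v)
  benignSeq-of-bounded-potential (suc N) a τ D D' a≤τ τ≤t D'≡ D'≥0 =
    move (atLeast t τ) (atLeast-benign D D' τ t τ≤t D'≡ D'≥0)
      (benignSeq-of-bounded-potential N a (lowered τ t) (fire G D (atLeast t τ)) D'
        (≤lowered τ t a<t a≤τ)
        (λ v → subst (lowered τ t v ≤_) (ℤ.+-assoc a (+ suc N) (- 1ℤ)) (lowered≤ τ t τ≤t v))
        (fire-Linequiv D D' τ (atLeast t τ) D'≡) D'≥0)
    where
    t = a + + suc N
    a<t : a < t
    a<t = ℤ.≤-<-trans (ℤ.i≤i+j a (+ N)) (ℤ.+-monoʳ-< a (+<+ (n<1+n N)))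

lemma2p1 : (G : Graph) (D D' : Div G) → Linequiv G D D' → Effective G D' → BenignSeq G D D'
lemma2p1 G D D' (σ , D'≡) D'≥0 =
  benignSeq-of-bounded-potential G ∣ M - a ∣ a σ D D'
    (minimum≤ σ) (λ v → subst (σ v ≤_) (sym a+spread≡M) (≤maximum σ v)) D'≡ D'≥0
  where
  a = minimum σ
  M = maximum σ
  a+spread≡M : a + + ∣ M - a ∣ ≡ M
  a+spread≡M = begin
    a + + ∣ M - a ∣  ≡⟨ cong (λ i → a + i) (ℤ.0≤i⇒+∣i∣≡i (ℤ.i≤j⇒0≤j-i a≤M)) ⟩
    a + (M - a)      ≡⟨ cancel a M ⟩
    M                ∎
    where
    open ≡-Reasoning
    a≤M : a ≤ M
    a≤M = ℤ.≤-trans (minimum≤ σ zero) (≤maximum σ zero)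
    cancel : ∀ i j → i + (j - i) ≡ j
    cancel = solve-∀
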